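{- Let $T$ be a binary search tree with a constant-size set $F$ of fingers (nodes), where the root is also regarded as a finger. Let $x,y$ be pseudofingers such that $x$ is an ancestor of $y$ and $x,y$ are adjacent in the hand, and let $\tau_{x,y}$ be the tendon between them. Then $\tau_{x,y}$ can be partitioned into two sets $T_{>}$ and $T_{<}$ such that the keys of the nodes of $T_{>}$, listed in level order (by increasing depth), are increasing, the keys of the nodes of $T_{<}$, listed in level order, are decreasing, and the maximum key in $T_{>}$ is smaller than the minimum key in $T_{<}$.
   Context: Given $T$ and fingers $F$ (including the root), the Steiner tree $S(T,F)$ is the union of the shortest paths in $T$ between all pairs of fingers. Prosthetic fingers are the nodes of degree $3$ in $S(T,F)$ not in $F$; pseudofingers are $F$ together with the prosthetic fingers. The hand is the tree obtained from $S(T,F)$ by contracting every non-pseudofinger vertex (these have degree 2). For pseudofingers $x,y$ adjacent in the hand with $x$ an ancestor of $y$, the tendon $\tau_{x,y}$ is the set of nodes on the shortest path in $S(T,F)$ from $x$ to $y$, excluding $x$ and $y$. -}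

module Defs where

open import Data.Nat using (ℕ; _<_)
open import Data.List using (List; []; _∷_; _++_; [_]; length)
open import Data.List.Membership.Propositional using (_∈_)
open import Data.List.Relation.Unary.Unique.Propositional using (Unique)
open import Data.Product using (Σ; ∃; _×_; _,_)
open import Data.Sum using (_⊎_)
open import Data.Bool using (Bool; true; false)
open import Data.Unit using (⊤)
open import Relation.Nullary using (¬_)
open import Relation.Binary.PropositionalEquality using (_≡_; _≢_)
open import Function.Bundles using (_⇔_)

data Tree : Set where
  leaf : Tree
  node : Tree → ℕ → Tree → Tree

-- A node is addressed by the path (list of directions) from the root.
data Dir : Set where
  L R : Dir

Path : Set
Path = List Dir

data IsNode : Tree → Path → Set where
  here : ∀ {l k r} → IsNode (node l k r) []
  goL  : ∀ {l k r p} → IsNode l p → IsNode (node l k r) (L ∷ p)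
  goR  : ∀ {l k r p} → IsNode r p → IsNode (node l k r) (R ∷ p)

data KeyAt : Tree → Path → ℕ → Set where
  here : ∀ {l k r} → KeyAt (node l k r) [] k
  goL  : ∀ {l k r p k'} → KeyAt l p k' → KeyAt (node l k r) (L ∷ p) k'
  goR  : ∀ {l k r p k'} → KeyAt r p k' → KeyAt (node l k r) (R ∷ p) k'

IsBST : Tree → Set
IsBST leaf = ⊤
IsBST (node l k r) =
  IsBST l × IsBST r
  × (∀ p k' → KeyAt l p k' → k' < k)
  × (∀ p k' → KeyAt r p k' → k < k')

_≼_ : Path → Path → Set
u ≼ v = ∃ λ s → u ++ s ≡ v

_≺_ : Path → Path → Set
u ≺ v = u ≼ v × u ≢ v

lca : Path → Path → Path
lca (L ∷ u) (L ∷ v) = L ∷ lca u v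
lca (R ∷ u) (R ∷ v) = R ∷ lca u v
lca _ _ = []

OnPath : Path → Path → Path → Set
OnPath u v w = (w ≼ u ⊎ w ≼ v) × (lca u v ≼ w)

Adj : Tree → Path → Path → Set
Adj t u v =
  IsNode t u × IsNode t v ×
  ((∃ λ d → v ≡ u ++ [ d ]) ⊎ (∃ λ d → u ≡ v ++ [ d ]))

InSteiner : List Path → Path → Set
InSteiner F w = ∃ λ u → ∃ λ v → u ∈ F × v ∈ F × OnPath u v w

DegreeIs : Tree → (Path → Set) → Path → ℕ → Set
DegreeIs t S w n =
  Σ (List Path) λ ns → Unique ns × length ns ≡ n ×
    (∀ v → v ∈ ns ⇔ (Adj t w v × S v))

Prosthetic : Tree → List Path → Path → Set
Prosthetic t F w =
  InSteiner F w × DegreeIs t (InSteiner F) w 3 × ¬ (w ∈ F)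

Pseudofinger : Tree → List Path → Path → Set
Pseudofinger t F w = w ∈ F ⊎ Prosthetic t F w

-- x, y are pseudofingers, x a proper ancestor of y, and x, y are adjacent
-- in the hand: the path between them in S(T,F) contains no other
-- pseudofinger (all its interior vertices get contracted).
HandAdjacentAnc : Tree → List Path → Path → Path → Set
HandAdjacentAnc t F x y =
  Pseudofinger t F x × Pseudofinger t F y × x ≺ y ×
  (∀ z → OnPath x y z → z ≢ x → z ≢ y → ¬ Pseudofinger t F z)

Tendon : List Path → Path → Path → Path → Set
Tendon F x y z = InSteiner F z × OnPath x y z × z ≢ x × z ≢ y

-- The tendon lies on the ancestor chain from x down to y, so its nodes are
-- ancestors of y, totally ordered by depth.  Put z in T> exactly when the
-- path from z to y turns right at z.  A deeper tendon node v then lies in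
-- the subtree of a shallower one u on the side leading to y, so the search
-- tree property gives key u < key v when that side is right and
-- key v < key u when it is left; this yields all three orderings.
module Submission where

open import Defs
open import Data.Nat using (ℕ; _<_; s≤s)
open import Data.Nat.Properties using (<-cmp; suc-injective)
open import Data.List using (List; []; _∷_; _++_; length)
open import Data.List.Properties using (++-assoc)
open import Data.List.Membership.Propositional using (_∈_)
open import Data.Product using (Σ; ∃; ∃₂; _×_; _,_)
open import Data.Sum using (inj₁; inj₂)
open import Data.Bool using (Bool; true; false)
open import Relation.Binary using (tri<; tri≈; tri>)
open import Relation.Binary.PropositionalEquality
  using (_≡_; refl; sym; trans; cong; module ≡-Reasoning)

≼-trans : ∀ {u v w} → u ≼ v → v ≼ w → u ≼ w
≼-trans {u} (s , refl) (s' , refl) = s ++ s' , sym (++-assoc u s s')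

∷-injective : ∀ {a b : Dir} {u v} → a ∷ u ≡ b ∷ v → a ≡ b × u ≡ v
∷-injective refl = refl , refl

≼-common-< : ∀ {u v y} → u ≼ y → v ≼ y → length u < length v →
  ∃₂ λ d w → v ≡ u ++ d ∷ w
≼-common-< {[]}    {d ∷ w}  _        _        _       = d , w , refl
≼-common-< {a ∷ u} {b ∷ v} (s , eu) (s' , ev) (s≤s lt)
  with ∷-injective (trans eu (sym ev))
... | refl , eq with ≼-common-< (s , refl) (s' , sym eq) lt
...   | d , w , refl = d , w , refl

≼-common-≡ : ∀ {u v y} → u ≼ y → v ≼ y → length u ≡ length v → u ≡ v
≼-common-≡ {[]}    {[]}    _        _        _  = refl
≼-common-≡ {a ∷ u} {b ∷ v} (s , eu) (s' , ev) le
  with ∷-injective (trans eu (sym ev))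
... | refl , eq = cong (a ∷_) (≼-common-≡ (s , refl) (s' , sym eq) (suc-injective le))

-- The direction in which the path from u to y leaves u (junk L when u is
-- not a proper ancestor of y).

dirTowards : Path → Path → Dir
dirTowards (_ ∷ u) (_ ∷ y) = dirTowards u y
dirTowards []      (d ∷ _) = d
dirTowards _       _       = L

dirTowards-++ : ∀ u d w → dirTowards u (u ++ d ∷ w) ≡ d
dirTowards-++ []      d w = refl
dirTowards-++ (_ ∷ u) d w = dirTowards-++ u d w

≼-common-<-via-dirTowards : ∀ {u v y} → u ≼ y → v ≼ y → length u < length v →
  ∃ λ w → v ≡ u ++ dirTowards u y ∷ w
≼-common-<-via-dirTowards {u} {y = y} u≼y (s , v++s≡y) lt
  with ≼-common-< u≼y (s , v++s≡y) lt
... | d , w , refl = w , cong (λ e → u ++ e ∷ w) (sym dirTowards-y≡d)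
  where
  open ≡-Reasoning
  dirTowards-y≡d : dirTowards u y ≡ d
  dirTowards-y≡d = begin
    dirTowards u y                        ≡⟨ cong (dirTowards u) (sym v++s≡y) ⟩
    dirTowards u ((u ++ d ∷ w) ++ s)      ≡⟨ cong (dirTowards u) (++-assoc u (d ∷ w) s) ⟩
    dirTowards u (u ++ d ∷ (w ++ s))      ≡⟨ dirTowards-++ u d (w ++ s) ⟩
    d                                     ∎

StepOrder : Dir → ℕ → ℕ → Set
StepOrder L ku kv = kv < ku
StepOrder R ku kv = ku < kv

keyAt-descendant : ∀ {t} → IsBST t → ∀ u {d w ku kv} →
  KeyAt t u ku → KeyAt t (u ++ d ∷ w) kv → StepOrder d ku kv
keyAt-descendant (_ , _ , left< , _) [] {L} here (goL k) = left< _ _ k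
keyAt-descendant (_ , _ , _ , <right) [] {R} here (goR k) = <right _ _ k
keyAt-descendant (bstˡ , _) (L ∷ u) (goL ku) (goL kv) = keyAt-descendant bstˡ u ku kv
keyAt-descendant (_ , bstʳ , _) (R ∷ u) (goR ku) (goR kv) = keyAt-descendant bstʳ u ku kv

keyAt-common-ancestors : ∀ {t u v y ku kv} → IsBST t →
  u ≼ y → v ≼ y → length u < length v →
  KeyAt t u ku → KeyAt t v kv → StepOrder (dirTowards u y) ku kv
keyAt-common-ancestors {u = u} bst u≼y v≼y lt ku kv
  with ≼-common-<-via-dirTowards u≼y v≼y lt
... | _ , refl = keyAt-descendant bst u ku kv

isRight : Dir → Bool
isRight L = false
isRight R = true

StepOrder-right : ∀ {d ku kv} → isRight d ≡ true → StepOrder d ku kv → ku < kv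
StepOrder-right {R} refl o = o

StepOrder-left : ∀ {d ku kv} → isRight d ≡ false → StepOrder d ku kv → kv < ku
StepOrder-left {L} refl o = o

tendon⇒≼ : ∀ {F x y z} → x ≼ y → Tendon F x y z → z ≼ y
tendon⇒≼ x≼y (_ , (inj₁ z≼x , _) , _) = ≼-trans z≼x x≼y
tendon⇒≼ _   (_ , (inj₂ z≼y , _) , _) = z≼y

lemma6 : (t : Tree) → IsBST t →
    (F : List Path) → (∀ f → f ∈ F → IsNode t f) → [] ∈ F →
    (x y : Path) → HandAdjacentAnc t F x y →
    Σ (Path → Bool) λ inGt →
      (∀ u v ku kv → Tendon F x y u → Tendon F x y v →
         inGt u ≡ true → inGt v ≡ true → length u < length v →
         KeyAt t u ku → KeyAt t v kv → ku < kv)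
      × (∀ u v ku kv → Tendon F x y u → Tendon F x y v →
         inGt u ≡ false → inGt v ≡ false → length u < length v →
         KeyAt t u ku → KeyAt t v kv → kv < ku)
      × (∀ u v ku kv → Tendon F x y u → Tendon F x y v →
         inGt u ≡ true → inGt v ≡ false →
         KeyAt t u ku → KeyAt t v kv → ku < kv)
lemma6 t bst F _ _ x y (_ , _ , (x≼y , _) , _) =
  inGt , increasing , decreasing , separated
  where
  inGt : Path → Bool
  inGt z = isRight (dirTowards z y)

  keys : ∀ {u v ku kv} → Tendon F x y u → Tendon F x y v → length u < length v →
    KeyAt t u ku → KeyAt t v kv → StepOrder (dirTowards u y) ku kv
  keys τu τv = keyAt-common-ancestors bst (tendon⇒≼ x≼y τu) (tendon⇒≼ x≼y τv)

  increasing : ∀ u v ku kv → Tendon F x y u → Tendon F x y v →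
    inGt u ≡ true → inGt v ≡ true → length u < length v →
    KeyAt t u ku → KeyAt t v kv → ku < kv
  increasing _ _ _ _ τu τv gu _ lt kᵤ kᵥ = StepOrder-right gu (keys τu τv lt kᵤ kᵥ)

  decreasing : ∀ u v ku kv → Tendon F x y u → Tendon F x y v →
    inGt u ≡ false → inGt v ≡ false → length u < length v →
    KeyAt t u ku → KeyAt t v kv → kv < ku
  decreasing _ _ _ _ τu τv gu _ lt kᵤ kᵥ = StepOrder-left gu (keys τu τv lt kᵤ kᵥ)

  separated : ∀ u v ku kv → Tendon F x y u → Tendon F x y v →
    inGt u ≡ true → inGt v ≡ false → KeyAt t u ku → KeyAt t v kv → ku < kv
  separated u v _ _ τu τv gu gv kᵤ kᵥ with <-cmp (length u) (length v)
  ... | tri< lt _ _ = StepOrder-right gu (keys τu τv lt kᵤ kᵥ)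
  ... | tri> _ _ gt = StepOrder-left gv (keys τv τu gt kᵥ kᵤ)
  ... | tri≈ _ le _ with ≼-common-≡ (tendon⇒≼ x≼y τu) (tendon⇒≼ x≼y τv) le
  ...   | refl with trans (sym gu) gv
  ...     | ()
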